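{- Let $k\geq 1$. If a simple graph $G$ is weakly $2k$-linked, then $G$ is $k$-edge-ordered.
   Context: A graph $G$ is weakly $r$-linked if, for any $2r$ (not necessarily distinct) vertices $s_1,\ldots,s_r,t_1,\ldots,t_r$, there exist pairwise edge-disjoint paths $P_1,\ldots,P_r$ with $P_i$ joining $s_i$ to $t_i$. A tour is a closed walk with no repeated edges. $G$ is $k$-edge-ordered if for every sequence $e_1,\ldots,e_k$ of $k$ distinct edges of $G$ there is a tour in $G$ containing $e_1,\ldots,e_k$ in this (cyclic) order. -}

module Defs where

open import Data.Nat using (ℕ; zero; suc)
open import Data.Bool using (Bool; true; false)
open import Data.Fin using (Fin) renaming (_<_ to _<ᶠ_)
open import Data.List using (List; []; _∷_; length; lookup)
open import Data.List.Membership.Propositional using (_∈_)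
open import Data.List.Relation.Unary.Unique.Propositional using (Unique)
open import Data.List.Relation.Unary.AllPairs using (AllPairs)
open import Data.Product using (Σ; ∃; _×_; _,_)
open import Data.Sum using (_⊎_)
open import Relation.Binary.PropositionalEquality using (_≡_; _≢_)
open import Relation.Nullary using (¬_)

record Graph (n : ℕ) : Set where
  field
    adj    : Fin n → Fin n → Bool
    sym    : ∀ u v → adj u v ≡ adj v u
    irrefl : ∀ v → adj v v ≡ false

module _ {n : ℕ} (G : Graph n) where
  open Graph G

  V : Set
  V = Fin n

  Adjacent : V → V → Set
  Adjacent u v = adj u v ≡ true

  -- An (oriented) edge occurrence is a pair of endpoints; two pairs
  -- denote the same (undirected) edge iff they agree up to orientation.
  SameEdge : V × V → V × V → Set
  SameEdge (a , b) (c , d) = (a ≡ c × b ≡ d) ⊎ (a ≡ d × b ≡ c)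

  data Walk : V → V → Set where
    [_]   : (v : V) → Walk v v
    step  : (u : V) {v w : V} → Adjacent u v → Walk v w → Walk u w

  vertices : ∀ {u w} → Walk u w → List V
  vertices [ v ]          = v ∷ []
  vertices (step u _ p)   = u ∷ vertices p

  edges : ∀ {u w} → Walk u w → List (V × V)
  edges [ v ]                   = []
  edges (step u {v} _ p)        = (u , v) ∷ edges p

  IsPath : ∀ {u w} → Walk u w → Set
  IsPath p = Unique (vertices p)

  IsTrail : ∀ {u w} → Walk u w → Set
  IsTrail p = AllPairs (λ e f → ¬ SameEdge e f) (edges p)

  EdgeDisjoint : ∀ {a b c d} → Walk a b → Walk c d → Set
  EdgeDisjoint p q = ∀ {e f} → e ∈ edges p → f ∈ edges q → ¬ SameEdge e f

  WeaklyLinked : ℕ → Set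
  WeaklyLinked r =
    (s t : Fin r → V) →
    Σ ((i : Fin r) → Walk (s i) (t i)) λ P →
      (∀ i → IsPath (P i)) ×
      (∀ i j → i ≢ j → EdgeDisjoint (P i) (P j))

  IsTour : ∀ {v} → Walk v v → Set
  IsTour p = IsTrail p

  -- the tour T traverses e 1 , … , e k in this order
  -- (cyclic order: since T is closed, the starting vertex is arbitrary)
  ContainsInOrder : ∀ {k v} → (e : Fin k → V × V) → Walk v v → Set
  ContainsInOrder {k} e T =
    Σ (Fin k → Fin (length (edges T))) λ idx →
      (∀ i j → i <ᶠ j → idx i <ᶠ idx j) ×
      (∀ i → SameEdge (lookup (edges T) (idx i)) (e i))

  EdgeOrdered : ℕ → Set
  EdgeOrdered k =
    (e : Fin k → V × V) →
    (∀ i → Adjacent (Data.Product.proj₁ (e i)) (Data.Product.proj₂ (e i))) →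
    (∀ i j → i ≢ j → ¬ SameEdge (e i) (e j)) →
    Σ V λ v → Σ (Walk v v) λ T → IsTour T × ContainsInOrder e T

{-# OPTIONS --safe #-}
-- Deleting an edge xy from a graph in which any r + 1 pairs of vertices can be joined
-- by edge-disjoint trails leaves a graph in which any r pairs can: join x to y by a
-- trail W alongside the r given pairs and, in the trail traversing xy (at most one
-- does), replace xy by W, which is edge-disjoint from all of them. Hence deleting
-- e₁ , … , e_k from a weakly 2k-linked graph leaves it weakly k-linked by trails.
-- Joining the head of each eᵢ to the tail of eᵢ₊₁ (indices mod k) by such trails and
-- closing up through the eᵢ yields a tour traversing e₁ , … , e_k in order.
module Submission where

open import Defs
open import Data.Nat using (ℕ; _≤_; _*_; zero; suc; _+_; s≤s; z≤n; z<s; s<s)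
open import Data.Nat.Properties using (+-suc; +-identityʳ)
open import Data.Fin using (Fin; _≟_) renaming (_<_ to _<ᶠ_)
open import Data.Fin.Properties using (suc-injective)
open import Data.List using (List; []; _∷_; _++_; length; lookup; tabulate)
open import Data.List.Relation.Unary.Any using (here; there)
open import Data.List.Relation.Unary.All as All using (All)
open import Data.List.Relation.Unary.AllPairs using ([]; _∷_)
open import Data.List.Relation.Unary.AllPairs.Properties as AllPairs using ()
open import Data.List.Relation.Binary.Sublist.Heterogeneous using (Sublist; _∷_; _∷ʳ_; minimum)
open import Data.List.Relation.Binary.Sublist.Heterogeneous.Properties using (++ˡ)
import Data.List.Membership.Propositional as Prop
open import Data.List.Membership.Setoid.Properties using (∈-++⁻; ∈-resp-≈; ∉⇒All[≉]; All[≉]⇒∉)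
import Data.List.Membership.Setoid as SetoidMembership
import Data.List.Relation.Binary.Disjoint.Setoid as SetoidDisjoint
open import Data.List.Relation.Unary.Unique.Setoid using (Unique)
open import Data.List.Relation.Unary.Unique.Setoid.Properties using (++⁺)
open import Data.Vec.Functional using () renaming (_∷_ to _◃_)
open import Data.Product as Product using (Σ-syntax; ∃; _×_; _,_; proj₁; proj₂)
open import Data.Sum as Sum using (_⊎_; inj₁; inj₂)
open import Function using (_∘_; id)
open import Level using (0ℓ)
open import Relation.Binary using (Setoid; IsEquivalence)
open import Relation.Binary.PropositionalEquality using (_≡_; _≢_; refl; sym; trans; cong; subst)
open import Relation.Nullary using (¬_; Dec; yes; no)
open import Relation.Nullary.Decidable using (_×-dec_; _⊎-dec_)

sublist⇒increasingIndex : ∀ {A B : Set} {R : A → B → Set} {m} (x : Fin m → A) {ys : List B} →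
  Sublist R (tabulate x) ys →
  Σ[ idx ∈ (Fin m → Fin (length ys)) ]
    (∀ i j → i <ᶠ j → idx i <ᶠ idx j) × (∀ i → R (x i) (lookup ys (idx i)))
sublist⇒increasingIndex {m = zero} x _ = (λ ()) , (λ ()) , (λ ())
sublist⇒increasingIndex {m = suc m} x (y ∷ʳ sub) =
  let idx , increasing , related = sublist⇒increasingIndex x sub
  in  Fin.suc ∘ idx , (λ i j i<j → s<s (increasing i j i<j)) , related
sublist⇒increasingIndex {R = R} {m = suc m} x {y ∷ ys} (r ∷ sub)
  with sublist⇒increasingIndex (x ∘ Fin.suc) sub
... | idx , increasing , related = idx′ , increasing′ , related′
  where
  idx′ : Fin (suc m) → Fin (suc (length ys))
  idx′ Fin.zero    = Fin.zero
  idx′ (Fin.suc i) = Fin.suc (idx i)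
  increasing′ : ∀ i j → i <ᶠ j → idx′ i <ᶠ idx′ j
  increasing′ Fin.zero    (Fin.suc j) _         = z<s
  increasing′ (Fin.suc i) (Fin.suc j) (s≤s i<j) = s<s (increasing i j i<j)
  related′ : ∀ i → R (x i) (lookup (y ∷ ys) (idx′ i))
  related′ Fin.zero    = r
  related′ (Fin.suc i) = related i

nextOr : ∀ {A : Set} {m} → (Fin (suc m) → A) → A → Fin (suc m) → A
nextOr {m = zero}  a z Fin.zero    = z
nextOr {m = suc m} a z Fin.zero    = a (Fin.suc Fin.zero)
nextOr {m = suc m} a z (Fin.suc i) = nextOr (a ∘ Fin.suc) z i

module _ {n : ℕ} (G : Graph n) where

  sameEdge-isEquivalence : IsEquivalence (SameEdge G)
  sameEdge-isEquivalence = record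
    { refl  = inj₁ (refl , refl)
    ; sym   = λ { (inj₁ (p , q)) → inj₁ (sym p , sym q) ; (inj₂ (p , q)) → inj₂ (sym q , sym p) }
    ; trans = λ { (inj₁ (p , q)) (inj₁ (r , s)) → inj₁ (trans p r , trans q s)
                ; (inj₁ (p , q)) (inj₂ (r , s)) → inj₂ (trans p r , trans q s)
                ; (inj₂ (p , q)) (inj₁ (r , s)) → inj₂ (trans p s , trans q r)
                ; (inj₂ (p , q)) (inj₂ (r , s)) → inj₁ (trans p s , trans q r) }
    }

  edgeSetoid : Setoid 0ℓ 0ℓ
  edgeSetoid = record { isEquivalence = sameEdge-isEquivalence }

  open Setoid edgeSetoid using (_≈_)
    renaming (refl to ≈-refl; sym to ≈-sym; trans to ≈-trans)
  open SetoidMembership edgeSetoid using () renaming (_∈_ to _∈ₑ_; _∉_ to _∉ₑ_)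
  open SetoidDisjoint edgeSetoid using (Disjoint; contractₗ; contractᵣ)

  sameEdge-swap : ∀ {u v} → (u , v) ≈ (v , u)
  sameEdge-swap = inj₂ (refl , refl)

  sameEdge? : (e f : Fin n × Fin n) → Dec (e ≈ f)
  sameEdge? (a , b) (c , d) = ((a ≟ c) ×-dec (b ≟ d)) ⊎-dec ((a ≟ d) ×-dec (b ≟ c))

  adjacent-sym : ∀ {u v} → Adjacent G u v → Adjacent G v u
  adjacent-sym {u} {v} = trans (Graph.sym G v u)

  _++ʷ_ : ∀ {a b c} → Walk G a b → Walk G b c → Walk G a c
  [ _ ]       ++ʷ q = q
  step u uv p ++ʷ q = step u uv (p ++ʷ q)

  edges-++ʷ : ∀ {a b c} (p : Walk G a b) (q : Walk G b c) →
    edges G (p ++ʷ q) ≡ edges G p ++ edges G q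
  edges-++ʷ [ _ ]             q = refl
  edges-++ʷ (step u {v} uv p) q = cong ((u , v) ∷_) (edges-++ʷ p q)

  ∈-++ʷ⁻ : ∀ {a b c} (p : Walk G a b) (q : Walk G b c) {f} →
    f ∈ₑ edges G (p ++ʷ q) → f ∈ₑ edges G p ⊎ f ∈ₑ edges G q
  ∈-++ʷ⁻ p q = ∈-++⁻ edgeSetoid (edges G p) ∘ subst (_ ∈ₑ_) (edges-++ʷ p q)

  ++ʷ-trail : ∀ {a b c} (p : Walk G a b) (q : Walk G b c) →
    IsTrail G p → IsTrail G q → Disjoint (edges G p) (edges G q) → IsTrail G (p ++ʷ q)
  ++ʷ-trail p q p-trail q-trail p#q =
    subst (Unique edgeSetoid) (sym (edges-++ʷ p q)) (++⁺ edgeSetoid p-trail q-trail p#q)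

  reverseʷ : ∀ {a b} → Walk G a b → Walk G b a
  reverseʷ [ v ]             = [ v ]
  reverseʷ (step u {v} uv p) = reverseʷ p ++ʷ step v (adjacent-sym uv) [ u ]

  ∈-reverseʷ⁻ : ∀ {a b} (p : Walk G a b) {f} → f ∈ₑ edges G (reverseʷ p) → f ∈ₑ edges G p
  ∈-reverseʷ⁻ [ v ] ()
  ∈-reverseʷ⁻ (step u {v} uv p) f∈ with ∈-++ʷ⁻ (reverseʷ p) (step v (adjacent-sym uv) [ u ]) f∈
  ... | inj₁ f∈p         = there (∈-reverseʷ⁻ p f∈p)
  ... | inj₂ (here f≈vu) = here (≈-trans f≈vu sameEdge-swap)

  reverseʷ-trail : ∀ {a b} (p : Walk G a b) → IsTrail G p → IsTrail G (reverseʷ p)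
  reverseʷ-trail [ v ]             _                  = []
  reverseʷ-trail (step u {v} uv p) (uv∉p ∷ p-trail) =
    ++ʷ-trail (reverseʷ p) (step v (adjacent-sym uv) [ u ])
      (reverseʷ-trail p p-trail) (All.[] ∷ [])
      λ { (f∈p , here f≈vu) →
        All[≉]⇒∉ edgeSetoid uv∉p
          (∈-resp-≈ edgeSetoid (≈-trans f≈vu sameEdge-swap) (∈-reverseʷ⁻ p f∈p)) }

  endpoints∈vertices : ∀ {a b} (p : Walk G a b) {u v} →
    (u , v) Prop.∈ edges G p → u Prop.∈ vertices G p × v Prop.∈ vertices G p
  endpoints∈vertices (step u _ [ v ])        (here refl) = here refl , there (here refl)
  endpoints∈vertices (step u _ (step v _ _)) (here refl) = here refl , there (here refl)
  endpoints∈vertices (step u _ p)            (there e∈p) =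
    Product.map there there (endpoints∈vertices p e∈p)

  path⇒trail : ∀ {a b} (p : Walk G a b) → IsPath G p → IsTrail G p
  path⇒trail [ v ]             _              = []
  path⇒trail (step u {v} uv p) (u∉p ∷ p-path) =
    All.tabulate uv≉ ∷ path⇒trail p p-path
    where
    uv≉ : ∀ {f} → f Prop.∈ edges G p → ¬ (u , v) ≈ f
    uv≉ f∈p (inj₁ (refl , _)) = All.lookup u∉p (proj₁ (endpoints∈vertices p f∈p)) refl
    uv≉ f∈p (inj₂ (refl , _)) = All.lookup u∉p (proj₂ (endpoints∈vertices p f∈p)) refl

  edgeDisjoint⇒disjoint : ∀ {a b c d} (p : Walk G a b) (q : Walk G c d) →
    EdgeDisjoint G p q → Disjoint (edges G p) (edges G q)
  edgeDisjoint⇒disjoint p q p#q (f∈p , f∈q) with Prop.find f∈p | Prop.find f∈q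
  ... | g , g∈p , f≈g | h , h∈q , f≈h = p#q g∈p h∈q (≈-trans (≈-sym f≈g) f≈h)

  module Detour {x y : Fin n} (W : Walk G x y) (W-trail : IsTrail G W) where

    bridge : ∀ {u v} → (u , v) ≈ (x , y) → Walk G u v
    bridge (inj₁ (refl , refl)) = W
    bridge (inj₂ (refl , refl)) = reverseʷ W

    bridge-trail : ∀ {u v} (uv≈xy : (u , v) ≈ (x , y)) → IsTrail G (bridge uv≈xy)
    bridge-trail (inj₁ (refl , refl)) = W-trail
    bridge-trail (inj₂ (refl , refl)) = reverseʷ-trail W W-trail

    ∈-bridge⁻ : ∀ {u v} (uv≈xy : (u , v) ≈ (x , y)) {f} →
      f ∈ₑ edges G (bridge uv≈xy) → f ∈ₑ edges G W
    ∈-bridge⁻ (inj₁ (refl , refl)) = id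
    ∈-bridge⁻ (inj₂ (refl , refl)) = ∈-reverseʷ⁻ W

    detour : ∀ {a b} → Walk G a b → Walk G a b
    detour [ v ] = [ v ]
    detour (step u {v} uv p) with sameEdge? (u , v) (x , y)
    ... | yes uv≈xy = bridge uv≈xy ++ʷ p
    ... | no  _     = step u uv (detour p)

    ∈-detour⁻ : ∀ {a b} (p : Walk G a b) → IsTrail G p → ∀ {f} → f ∈ₑ edges G (detour p) →
      (f ∈ₑ edges G p × ¬ f ≈ (x , y)) ⊎ (f ∈ₑ edges G W × (x , y) ∈ₑ edges G p)
    ∈-detour⁻ [ v ] _ ()
    ∈-detour⁻ (step u {v} uv p) (uv∉p ∷ p-trail) f∈ with sameEdge? (u , v) (x , y)
    ... | yes uv≈xy with ∈-++ʷ⁻ (bridge uv≈xy) p f∈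
    ...   | inj₁ f∈W = inj₂ (∈-bridge⁻ uv≈xy f∈W , here (≈-sym uv≈xy))
    ...   | inj₂ f∈p = inj₁ (there f∈p , λ f≈xy →
              All[≉]⇒∉ edgeSetoid uv∉p (∈-resp-≈ edgeSetoid (≈-trans f≈xy (≈-sym uv≈xy)) f∈p))
    ∈-detour⁻ (step u {v} uv p) _ (here f≈uv) | no uv≉xy =
      inj₁ (here f≈uv , λ f≈xy → uv≉xy (≈-trans (≈-sym f≈uv) f≈xy))
    ∈-detour⁻ (step u {v} uv p) (_ ∷ p-trail) (there f∈) | no _ =
      Sum.map (Product.map₁ there) (Product.map₂ there) (∈-detour⁻ p p-trail f∈)

    detour-trail : ∀ {a b} (p : Walk G a b) → IsTrail G p → Disjoint (edges G p) (edges G W) →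
      IsTrail G (detour p)
    detour-trail [ v ] _ _ = []
    detour-trail (step u {v} uv p) (uv∉p ∷ p-trail) p#W with sameEdge? (u , v) (x , y)
    ... | yes uv≈xy =
      ++ʷ-trail (bridge uv≈xy) p (bridge-trail uv≈xy) p-trail
        λ (f∈W , f∈p) → p#W (there f∈p , ∈-bridge⁻ uv≈xy f∈W)
    ... | no _ = ∉⇒All[≉] edgeSetoid uv∉detour ∷ detour-trail p p-trail (contractₗ p#W)
      where
      uv∉detour : (u , v) ∉ₑ edges G (detour p)
      uv∉detour uv∈ with ∈-detour⁻ p p-trail uv∈
      ... | inj₁ (uv∈p , _) = All[≉]⇒∉ edgeSetoid uv∉p uv∈p
      ... | inj₂ (uv∈W , _) = p#W (here ≈-refl , uv∈W)

  -- Trails rather than paths, since a detour of a path need not be a path.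
  record Linkage {r} (s t : Fin r → Fin n) (F : List (Fin n × Fin n)) : Set where
    field
      path     : ∀ i → Walk G (s i) (t i)
      trail    : ∀ i → IsTrail G (path i)
      disjoint : ∀ i j → i ≢ j → Disjoint (edges G (path i)) (edges G (path j))
      avoids   : ∀ i → Disjoint (edges G (path i)) F

  WeaklyLinkedAvoiding : ℕ → List (Fin n × Fin n) → Set
  WeaklyLinkedAvoiding r F = (s t : Fin r → Fin n) → Linkage s t F

  weaklyLinked⇒avoiding[] : ∀ {r} → WeaklyLinked G r → WeaklyLinkedAvoiding r []
  weaklyLinked⇒avoiding[] linked s t with linked s t
  ... | P , P-path , P-disjoint = record
    { path     = P
    ; trail    = λ i → path⇒trail (P i) (P-path i)
    ; disjoint = λ i j i≢j → edgeDisjoint⇒disjoint (P i) (P j) (P-disjoint i j i≢j)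
    ; avoids   = λ i ()
    }

  avoiding-∷ : ∀ {r F} x y → WeaklyLinkedAvoiding (suc r) F → WeaklyLinkedAvoiding r ((x , y) ∷ F)
  avoiding-∷ {F = F} x y linked s t = record
    { path     = detour ∘ P
    ; trail    = λ i → detour-trail (P i) (trail (Fin.suc i)) (disjoint (Fin.suc i) Fin.zero λ ())
    ; disjoint = disjoint′
    ; avoids   = avoids′
    }
    where
    open Linkage (linked (x ◃ s) (y ◃ t))
    open Detour (path Fin.zero) (trail Fin.zero)

    P : ∀ i → Walk G (s i) (t i)
    P = path ∘ Fin.suc

    ∈-detour-P⁻ : ∀ i {f} → f ∈ₑ edges G (detour (P i)) →
      (f ∈ₑ edges G (P i) × ¬ f ≈ (x , y)) ⊎ (f ∈ₑ edges G (path Fin.zero) × (x , y) ∈ₑ edges G (P i))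
    ∈-detour-P⁻ i = ∈-detour⁻ (P i) (trail (Fin.suc i))

    disjoint′ : ∀ i j → i ≢ j → Disjoint (edges G (detour (P i))) (edges G (detour (P j)))
    disjoint′ i j i≢j (f∈i , f∈j) with ∈-detour-P⁻ i f∈i | ∈-detour-P⁻ j f∈j
    ... | inj₁ (f∈Pi , _) | inj₁ (f∈Pj , _) =
      disjoint (Fin.suc i) (Fin.suc j) (i≢j ∘ suc-injective) (f∈Pi , f∈Pj)
    ... | inj₁ (f∈Pi , _) | inj₂ (f∈W , _) = disjoint (Fin.suc i) Fin.zero (λ ()) (f∈Pi , f∈W)
    ... | inj₂ (f∈W , _) | inj₁ (f∈Pj , _) = disjoint (Fin.suc j) Fin.zero (λ ()) (f∈Pj , f∈W)
    ... | inj₂ (_ , xy∈Pi) | inj₂ (_ , xy∈Pj) =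
      disjoint (Fin.suc i) (Fin.suc j) (i≢j ∘ suc-injective) (xy∈Pi , xy∈Pj)

    avoids′ : ∀ i → Disjoint (edges G (detour (P i))) ((x , y) ∷ F)
    avoids′ i (f∈ , f∈xyF) with ∈-detour-P⁻ i f∈ | f∈xyF
    ... | inj₁ (_ , f≉xy) | here f≈xy = f≉xy f≈xy
    ... | inj₁ (f∈Pi , _) | there f∈F = avoids (Fin.suc i) (f∈Pi , f∈F)
    ... | inj₂ (f∈W , xy∈Pi) | here f≈xy =
      disjoint (Fin.suc i) Fin.zero (λ ()) (xy∈Pi , ∈-resp-≈ edgeSetoid f≈xy f∈W)
    ... | inj₂ (f∈W , _) | there f∈F = avoids Fin.zero (f∈W , f∈F)

  avoiding-tabulate : ∀ m r → WeaklyLinkedAvoiding (m + r) [] →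
    (e : Fin m → Fin n × Fin n) → WeaklyLinkedAvoiding r (tabulate e)
  avoiding-tabulate zero    r linked e = linked
  avoiding-tabulate (suc m) r linked e =
    avoiding-∷ (proj₁ (e Fin.zero)) (proj₂ (e Fin.zero))
      (avoiding-tabulate m (suc r) (subst (λ r′ → WeaklyLinkedAvoiding r′ []) (sym (+-suc m r)) linked)
        (e ∘ Fin.suc))

  record EdgeChain (m : ℕ) (z : Fin n) : Set where
    field
      from to  : Fin (suc m) → Fin n
      adjacent : ∀ i → Adjacent G (from i) (to i)
      link     : ∀ i → Walk G (to i) (nextOr from z i)

    edge : Fin (suc m) → Fin n × Fin n
    edge i = from i , to i

  dropFirst : ∀ {m z} → EdgeChain (suc m) z → EdgeChain m z
  dropFirst σ = record
    { from = from ∘ Fin.suc ; to = to ∘ Fin.suc ; adjacent = adjacent ∘ Fin.suc ; link = link ∘ Fin.suc }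
    where open EdgeChain σ

  chain : ∀ {m z} (σ : EdgeChain m z) → Walk G (EdgeChain.from σ Fin.zero) z
  chain {zero}  σ = step (from Fin.zero) (adjacent Fin.zero) (link Fin.zero)
    where open EdgeChain σ
  chain {suc m} σ = step (from Fin.zero) (adjacent Fin.zero) (link Fin.zero ++ʷ chain (dropFirst σ))
    where open EdgeChain σ

  chain-⊇ : ∀ {m z} (σ : EdgeChain m z) → Sublist _≡_ (tabulate (EdgeChain.edge σ)) (edges G (chain σ))
  chain-⊇ {zero}  σ = refl ∷ minimum _
  chain-⊇ {suc m} σ =
    refl ∷ subst (Sublist _≡_ _) (sym (edges-++ʷ (link Fin.zero) (chain (dropFirst σ))))
             (++ˡ (edges G (link Fin.zero)) (chain-⊇ (dropFirst σ)))
    where open EdgeChain σ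

  ∈-chain⁻ : ∀ {m z} (σ : EdgeChain m z) {f} → f ∈ₑ edges G (chain σ) →
    f ∈ₑ tabulate (EdgeChain.edge σ) ⊎ ∃ λ i → f ∈ₑ edges G (EdgeChain.link σ i)
  ∈-chain⁻ {zero}  σ (here f≈e) = inj₁ (here f≈e)
  ∈-chain⁻ {zero}  σ (there f∈) = inj₂ (Fin.zero , f∈)
  ∈-chain⁻ {suc m} σ (here f≈e) = inj₁ (here f≈e)
  ∈-chain⁻ {suc m} σ (there f∈) with ∈-++ʷ⁻ (EdgeChain.link σ Fin.zero) (chain (dropFirst σ)) f∈
  ... | inj₁ f∈link = inj₂ (Fin.zero , f∈link)
  ... | inj₂ f∈rest = Sum.map there (Product.map Fin.suc id) (∈-chain⁻ (dropFirst σ) f∈rest)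

  chain-trail : ∀ {m z} (σ : EdgeChain m z) → let open EdgeChain σ in
    Unique edgeSetoid (tabulate edge) →
    (∀ i → IsTrail G (link i)) →
    (∀ i j → i ≢ j → Disjoint (edges G (link i)) (edges G (link j))) →
    (∀ i → Disjoint (edges G (link i)) (tabulate edge)) →
    IsTrail G (chain σ)
  chain-trail {zero} σ _ link-trail _ link#edges =
    ∉⇒All[≉] edgeSetoid (λ e∈link → link#edges Fin.zero (e∈link , here ≈-refl)) ∷ link-trail Fin.zero
  chain-trail {suc m} {z} σ (e₀∉edges ∷ edges-unique) link-trail link#link link#edges =
    ∉⇒All[≉] edgeSetoid e₀∉ ∷ ++ʷ-trail (link Fin.zero) rest (link-trail Fin.zero) rest-trail link₀#rest
    where
    open EdgeChain σ

    rest : Walk G (from (Fin.suc Fin.zero)) z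
    rest = chain (dropFirst σ)

    rest-trail : IsTrail G rest
    rest-trail = chain-trail (dropFirst σ) edges-unique (link-trail ∘ Fin.suc)
      (λ i j i≢j → link#link (Fin.suc i) (Fin.suc j) (i≢j ∘ suc-injective))
      (λ i → contractᵣ (link#edges (Fin.suc i)))

    e₀∉ : edge Fin.zero ∉ₑ edges G (link Fin.zero ++ʷ rest)
    e₀∉ e₀∈ with ∈-++ʷ⁻ (link Fin.zero) rest e₀∈
    ... | inj₁ e₀∈link₀ = link#edges Fin.zero (e₀∈link₀ , here ≈-refl)
    ... | inj₂ e₀∈rest with ∈-chain⁻ (dropFirst σ) e₀∈rest
    ...   | inj₁ e₀∈edges       = All[≉]⇒∉ edgeSetoid e₀∉edges e₀∈edges
    ...   | inj₂ (i , e₀∈linkᵢ) = link#edges (Fin.suc i) (e₀∈linkᵢ , here ≈-refl)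

    link₀#rest : Disjoint (edges G (link Fin.zero)) (edges G rest)
    link₀#rest (f∈link₀ , f∈rest) with ∈-chain⁻ (dropFirst σ) f∈rest
    ... | inj₁ f∈edges       = link#edges Fin.zero (f∈link₀ , there f∈edges)
    ... | inj₂ (i , f∈linkᵢ) = link#link Fin.zero (Fin.suc i) (λ ()) (f∈link₀ , f∈linkᵢ)

lemma6p1 : (k : ℕ) → 1 ≤ k → {n : ℕ} (G : Graph n) →
    WeaklyLinked G (2 * k) → EdgeOrdered G k
lemma6p1 (suc k) (s≤s z≤n) G linked e adjacent distinct = start , tour , tour-trail , in-order
  where
  linked-k+k : WeaklyLinked G (suc k + suc k)
  linked-k+k = subst (WeaklyLinked G) (cong (suc k +_) (+-identityʳ (suc k))) linked

  start : V G
  start = proj₁ (e Fin.zero)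

  open Linkage (avoiding-tabulate G (suc k) (suc k) (weaklyLinked⇒avoiding[] G linked-k+k) e
                  (proj₂ ∘ e) (nextOr (proj₁ ∘ e) start))

  σ : EdgeChain G k start
  σ = record { from = proj₁ ∘ e ; to = proj₂ ∘ e ; adjacent = adjacent ; link = path }

  tour : Walk G start start
  tour = chain G σ

  tour-trail : IsTour G tour
  tour-trail = chain-trail G σ (AllPairs.tabulate⁺ (distinct _ _)) trail disjoint avoids

  in-order : ContainsInOrder G e tour
  in-order with sublist⇒increasingIndex e (chain-⊇ G σ)
  ... | idx , increasing , e≡lookup =
    idx , increasing , λ i → Setoid.reflexive (edgeSetoid G) (sym (e≡lookup i))
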